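{- Let $n \geq 5$ be an odd integer. Then Player $A$ has a winning strategy in the game $Z(n,d)$ for every $d \in \left\{\frac{n-1}{2}, \frac{n+1}{2}, n, n+1, n+2\right\}$.
   Context: For integers $n \geq 4$ and $d \geq 2$, $Z(n,d)$ is the following two-player game. Initially the board contains the numbers $1,2,\dots,n$. Players $A$ and $B$ alternately cross out (remove) one number from the board, with $A$ moving first, until exactly two numbers remain. If the sum of the two remaining numbers is divisible by $d$, $A$ wins; otherwise $B$ wins. A player has a winning strategy if that player can force a win regardless of the opponent's moves. -}

module Defs where

open import Data.Nat using (ℕ; suc; _+_; _≥_)
open import Data.Nat.Divisibility using (_∣_)
open import Data.List using (List; []; _∷_; length; applyUpTo)
open import Data.List.Membership.Propositional using (_∈_)
open import Data.List.Relation.Unary.Any using (_─_)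
open import Data.Product using (∃)
open import Relation.Binary.PropositionalEquality using (_≡_)

initialBoard : ℕ → List ℕ
initialBoard n = applyUpTo suc n

-- A crosses out a number = picks a position p : x ∈ board and continues with board ─ p.
-- The game ends when exactly two numbers remain; A wins iff their sum is divisible by d.
mutual
  data AWinsA (d : ℕ) : List ℕ → Set where
    endA  : ∀ x y → d ∣ (x + y) → AWinsA d (x ∷ y ∷ [])
    moveA : ∀ b → length b ≥ 3 → ∀ {x} (p : x ∈ b) → AWinsB d (b ─ p) → AWinsA d b

  data AWinsB (d : ℕ) : List ℕ → Set where
    endB  : ∀ x y → d ∣ (x + y) → AWinsB d (x ∷ y ∷ [])
    moveB : ∀ b → length b ≥ 3 → (∀ {x} (p : x ∈ b) → AWinsA d (b ─ p)) → AWinsB d b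

AHasWinningStrategy : ℕ → ℕ → Set
AHasWinningStrategy n d = AWinsA d (initialBoard n)

-- Write n = 2k + 1.  A first crosses out one number s so that the remaining 2k numbers split
-- into pairs {y, f y} whose sums are divisible by d; afterwards A answers every number B
-- crosses out with its partner, so the last two numbers form a pair.  The pairings are
-- reflections y ↦ c − y: for d = n remove n and take c = n; for d = n + 2 remove 1 and take
-- c = n + 2; for d = k + 1 and d = n + 1 = 2(k + 1) remove the midpoint k + 1 and take
-- c = 2k + 2; for d = k remove n and take c = 2k, except that 2k (reflected to 0, which is
-- not on the board) is paired with the fixed point k instead, with sum 3k.
module Submission where

open import Defs
open import Data.Nat
open import Data.Nat.Properties
open import Data.Nat.Divisibility using (_∣_; ∣-refl; ∣-trans; ∣-reflexive; ∣m∣n⇒∣m+n; n∣m*n)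
open import Data.List using (List; []; _∷_; length)
open import Data.List.Properties using (length-applyUpTo; length-removeAt′)
open import Data.List.Membership.Propositional using (_∈_; _∉_)
open import Data.List.Membership.Propositional.Properties using (∈-applyUpTo⁺; ∈-applyUpTo⁻)
open import Data.List.Relation.Unary.Any using (here; there; index; _─_)
import Data.List.Relation.Unary.All as All
import Data.List.Relation.Unary.All.Properties as All
open import Data.List.Relation.Unary.Unique.Propositional using (Unique; []; _∷_)
open import Data.List.Relation.Unary.Unique.Propositional.Properties using (applyUpTo⁺₁)
open import Data.Product using (_×_; _,_; proj₁; proj₂; ∃₂)
open import Data.Sum using (inj₁; inj₂)
open import Data.Empty using (⊥-elim)
open import Function using (_∘_; case_of_)
open import Level using (0ℓ)
open import Relation.Nullary using (¬_; yes; no)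
open import Relation.Unary using (Pred; _⊆_; _≐_; _∪_; _∖_; ｛_｝)
open import Relation.Unary.Properties using (≐-trans; ≐-sym)
open import Relation.Binary.PropositionalEquality

∖-respˡ-≐ : ∀ {a} {A : Set a} {P Q R : Pred A a} → P ≐ Q → P ∖ R ≐ Q ∖ R
∖-respˡ-≐ (P⊆Q , Q⊆P) = (λ (p , r) → P⊆Q p , r) , (λ (q , r) → Q⊆P q , r)

module _ {a} {A : Set a} {x : A} where

  ∈-─⁻ : ∀ {y xs} (p : x ∈ xs) → y ∈ (xs ─ p) → y ∈ xs
  ∈-─⁻ (here refl) y∈ = there y∈
  ∈-─⁻ (there p) (here y≡) = here y≡
  ∈-─⁻ (there p) (there y∈) = there (∈-─⁻ p y∈)

  ∈-─⁺ : ∀ {y xs} (p : x ∈ xs) → y ∈ xs → x ≢ y → y ∈ (xs ─ p)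
  ∈-─⁺ (here refl) (here refl) x≢y = ⊥-elim (x≢y refl)
  ∈-─⁺ (here refl) (there y∈) x≢y = y∈
  ∈-─⁺ (there p) (here y≡) x≢y = here y≡
  ∈-─⁺ (there p) (there y∈) x≢y = there (∈-─⁺ p y∈ x≢y)

  ∉-─ : ∀ {xs} → Unique xs → (p : x ∈ xs) → x ∉ (xs ─ p)
  ∉-─ (x≢ ∷ _) (here refl) x∈ = All.lookup x≢ x∈ refl
  ∉-─ (z≢ ∷ _) (there p) (here refl) = All.lookup z≢ p refl
  ∉-─ (_ ∷ u) (there p) (there x∈) = ∉-─ u p x∈

  Unique-─ : ∀ {xs} → Unique xs → (p : x ∈ xs) → Unique (xs ─ p)
  Unique-─ (_ ∷ u) (here refl) = u
  Unique-─ (z≢ ∷ u) (there p) = All.─⁺ p z≢ ∷ Unique-─ u p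

  ∈-─≐ : ∀ {xs} → Unique xs → (p : x ∈ xs) → (_∈ (xs ─ p)) ≐ (_∈ xs) ∖ ｛ x ｝
  ∈-─≐ u p =
    (λ y∈ → ∈-─⁻ p y∈ , λ { refl → ∉-─ u p y∈ }) ,
    (λ (y∈ , x≢y) → ∈-─⁺ p y∈ x≢y)

record Pairing (P : Pred ℕ 0ℓ) (d : ℕ) (f : ℕ → ℕ) : Set where
  field
    closed         : ∀ {y} → P y → P (f y)
    no-fixed-point : ∀ {y} → P y → f y ≢ y
    involutive     : ∀ {y} → P y → f (f y) ≡ y
    divides-sum    : ∀ {y} → P y → d ∣ y + f y

open Pairing

module _ {d : ℕ} {f : ℕ → ℕ} where

  Pairing-resp-≐ : {P Q : Pred ℕ 0ℓ} → P ≐ Q → Pairing P d f → Pairing Q d f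
  Pairing-resp-≐ (P⊆Q , Q⊆P) π = record
    { closed         = P⊆Q ∘ closed π ∘ Q⊆P
    ; no-fixed-point = no-fixed-point π ∘ Q⊆P
    ; involutive     = involutive π ∘ Q⊆P
    ; divides-sum    = divides-sum π ∘ Q⊆P
    }

  Pairing-∣ : ∀ {P c} → c ∣ d → Pairing P d f → Pairing P c f
  Pairing-∣ c∣d π = record
    { closed         = closed π
    ; no-fixed-point = no-fixed-point π
    ; involutive     = involutive π
    ; divides-sum    = ∣-trans c∣d ∘ divides-sum π
    }

  Pairing-∖-pair : ∀ {P x} → Pairing P d f → P x → Pairing ((P ∖ ｛ x ｝) ∖ ｛ f x ｝) d f
  Pairing-∖-pair {x = x} π Px = record
    { closed         = λ ((Py , x≢y) , fx≢y) →
        (closed π Py , λ x≡fy → fx≢y (trans (cong f x≡fy) (involutive π Py))) ,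
        λ fx≡fy → x≢y (trans (sym (involutive π Px)) (trans (cong f fx≡fy) (involutive π Py)))
    ; no-fixed-point = no-fixed-point π ∘ proj₁ ∘ proj₁
    ; involutive     = involutive π ∘ proj₁ ∘ proj₁
    ; divides-sum    = divides-sum π ∘ proj₁ ∘ proj₁
    }

withPair : ℕ → ℕ → (ℕ → ℕ) → ℕ → ℕ
withPair u v f y with u ≟ y | v ≟ y
... | yes _ | _     = v
... | no _  | yes _ = u
... | no _  | no _  = f y

module _ {u v : ℕ} {f : ℕ → ℕ} where

  withPair-left : withPair u v f u ≡ v
  withPair-left with u ≟ u
  ... | yes _   = refl
  ... | no u≢u = ⊥-elim (u≢u refl)

  withPair-right : u ≢ v → withPair u v f v ≡ u
  withPair-right u≢v with u ≟ v | v ≟ v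
  ... | yes u≡v | _      = ⊥-elim (u≢v u≡v)
  ... | no _    | yes _  = refl
  ... | no _    | no v≢v = ⊥-elim (v≢v refl)

  withPair-other : ∀ {y} → u ≢ y → v ≢ y → withPair u v f y ≡ f y
  withPair-other {y} u≢y v≢y with u ≟ y | v ≟ y
  ... | yes u≡y | _       = ⊥-elim (u≢y u≡y)
  ... | no _    | yes v≡y = ⊥-elim (v≢y v≡y)
  ... | no _    | no _    = refl

  Pairing-∪-pair : ∀ {P d} → Pairing P d f → ¬ P u → ¬ P v → u ≢ v → d ∣ u + v →
                   Pairing (P ∪ ｛ u ｝ ∪ ｛ v ｝) d (withPair u v f)
  Pairing-∪-pair {P} {d} π u∉P v∉P u≢v d∣u+v = record
    { closed         = closed′
    ; no-fixed-point = no-fixed-point′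
    ; involutive     = involutive′
    ; divides-sum    = divides-sum′
    }
    where
    g = withPair u v f

    outside : ∀ {y} → P y → u ≢ y × v ≢ y
    outside Py = (λ { refl → u∉P Py }) , (λ { refl → v∉P Py })

    g-inside : ∀ {y} → P y → g y ≡ f y
    g-inside Py = let u≢y , v≢y = outside Py in withPair-other u≢y v≢y

    closed′ : ∀ {y} → (P ∪ ｛ u ｝ ∪ ｛ v ｝) y → (P ∪ ｛ u ｝ ∪ ｛ v ｝) (g y)
    closed′ (inj₁ Py)        = inj₁ (subst P (sym (g-inside Py)) (closed π Py))
    closed′ (inj₂ (inj₁ refl)) = inj₂ (inj₂ (sym withPair-left))
    closed′ (inj₂ (inj₂ refl)) = inj₂ (inj₁ (sym (withPair-right u≢v)))

    no-fixed-point′ : ∀ {y} → (P ∪ ｛ u ｝ ∪ ｛ v ｝) y → g y ≢ y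
    no-fixed-point′ (inj₁ Py)        = no-fixed-point π Py ∘ trans (sym (g-inside Py))
    no-fixed-point′ (inj₂ (inj₁ refl)) = u≢v ∘ sym ∘ trans (sym withPair-left)
    no-fixed-point′ (inj₂ (inj₂ refl)) = u≢v ∘ trans (sym (withPair-right u≢v))

    involutive′ : ∀ {y} → (P ∪ ｛ u ｝ ∪ ｛ v ｝) y → g (g y) ≡ y
    involutive′ {y} (inj₁ Py) = begin
      g (g y)   ≡⟨ cong g (g-inside Py) ⟩
      g (f y)   ≡⟨ g-inside (closed π Py) ⟩
      f (f y)   ≡⟨ involutive π Py ⟩
      y         ∎
      where open ≡-Reasoning
    involutive′ (inj₂ (inj₁ refl)) = trans (cong g withPair-left) (withPair-right u≢v)
    involutive′ (inj₂ (inj₂ refl)) = trans (cong g (withPair-right u≢v)) withPair-left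

    divides-sum′ : ∀ {y} → (P ∪ ｛ u ｝ ∪ ｛ v ｝) y → d ∣ y + g y
    divides-sum′ (inj₁ Py) = subst (λ z → d ∣ _ + z) (sym (g-inside Py)) (divides-sum π Py)
    divides-sum′ (inj₂ (inj₁ refl)) = subst (λ z → d ∣ u + z) (sym withPair-left) d∣u+v
    divides-sum′ (inj₂ (inj₂ refl)) =
      subst (λ z → d ∣ v + z) (sym (withPair-right u≢v)) (subst (d ∣_) (+-comm u v) d∣u+v)

Interval : ℕ → ℕ → Pred ℕ 0ℓ
Interval a b y = a ≤ y × y ≤ b

Half : ℕ → Pred ℕ 0ℓ
Half c y = 2 * y ≡ c

Interval-∖-max : ∀ {a b} → Interval a (suc b) ∖ ｛ suc b ｝ ≐ Interval a b
Interval-∖-max =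
  (λ ((a≤y , y≤1+b) , 1+b≢y) → a≤y , s≤s⁻¹ (≤∧≢⇒< y≤1+b (1+b≢y ∘ sym))) ,
  (λ (a≤y , y≤b) → (a≤y , m≤n⇒m≤1+n y≤b) , (<⇒≢ (s≤s y≤b) ∘ sym))

Interval-∖-min : ∀ {a b} → Interval a b ∖ ｛ a ｝ ≐ Interval (suc a) b
Interval-∖-min =
  (λ ((a≤y , y≤b) , a≢y) → ≤∧≢⇒< a≤y a≢y , y≤b) ,
  (λ (a<y , y≤b) → (<⇒≤ a<y , y≤b) , <⇒≢ a<y)

∖-｛｝≐∖-Half : ∀ {P : Pred ℕ 0ℓ} {s} → P ∖ ｛ s ｝ ≐ P ∖ Half (2 * s)
∖-｛｝≐∖-Half {s = s} =
  (λ {y} (Py , s≢y) → Py , λ 2y≡2s → s≢y (sym (*-cancelˡ-≡ y s 2 2y≡2s))) ,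
  (λ (Py , y∉Half) → Py , λ { refl → y∉Half refl })

module _ {c : ℕ} where

  ∸-fixed⇒Half : ∀ {y} → y ≤ c → c ∸ y ≡ y → Half c y
  ∸-fixed⇒Half {y} y≤c c∸y≡y = begin
    2 * y       ≡⟨ cong (y +_) (+-identityʳ y) ⟩
    y + y       ≡⟨ cong (y +_) c∸y≡y ⟨
    y + (c ∸ y) ≡⟨ m+[n∸m]≡n y≤c ⟩
    c           ∎
    where open ≡-Reasoning

  Half⇒∸-fixed : ∀ {y} → Half c y → c ∸ y ≡ y
  Half⇒∸-fixed {y} refl = trans (m+n∸m≡n y (y + 0)) (+-identityʳ y)

reflection-pairing : ∀ {a b c} → a + b ≡ c → Pairing (Interval a b ∖ Half c) c (c ∸_)
reflection-pairing {a} {b} refl = record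
  { closed         = λ y∈@((a≤y , y≤b) , _) →
      ( ≤-trans (≤-reflexive (sym (m+n∸n≡m a b))) (∸-monoʳ-≤ c y≤b)
      , ≤-trans (∸-monoʳ-≤ c a≤y) (≤-reflexive (m+n∸m≡n a b)) ) ,
      λ c∸y∈Half → not-Half y∈ (∸-fixed⇒Half (y≤c y∈)
        (trans (sym (Half⇒∸-fixed c∸y∈Half)) (m∸[m∸n]≡n (y≤c y∈))))
  ; no-fixed-point = λ y∈ → not-Half y∈ ∘ ∸-fixed⇒Half (y≤c y∈)
  ; involutive     = m∸[m∸n]≡n ∘ y≤c
  ; divides-sum    = ∣-reflexive ∘ sym ∘ m+[n∸m]≡n ∘ y≤c
  }
  where
  c = a + b

  y≤c : ∀ {y} → (Interval a b ∖ Half c) y → y ≤ c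
  y≤c ((_ , y≤b) , _) = m≤n⇒m≤o+n a y≤b

  not-Half : ∀ {y} → (Interval a b ∖ Half c) y → ¬ Half c y
  not-Half (_ , y∉Half) = y∉Half

reflection-pairing-odd : ∀ {a b j} → a + b ≡ suc (2 * j) →
                         Pairing (Interval a b) (suc (2 * j)) (suc (2 * j) ∸_)
reflection-pairing-odd {j = j} a+b≡c =
  Pairing-resp-≐ (proj₁ , λ {y} y∈ → y∈ , λ 2y≡c → even≢odd y j 2y≡c) (reflection-pairing a+b≡c)

Pairing-─-pair : ∀ {d f x} {b : List ℕ} → Unique b → Pairing (_∈ b) d f →
                 (p : x ∈ b) (q : f x ∈ (b ─ p)) → Pairing (_∈ (b ─ p ─ q)) d f
Pairing-─-pair u π p q =
  Pairing-resp-≐ (≐-sym (≐-trans (∈-─≐ (Unique-─ u p) q) (∖-respˡ-≐ (∈-─≐ u p))))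
                 (Pairing-∖-pair π p)

pairing-strategy : ∀ m {d f} {b : List ℕ} → Unique b → Pairing (_∈ b) d f →
                   length b ≡ 2 * suc m → AWinsB d b
pairing-strategy zero {b = x ∷ y ∷ []} u π _ with closed π (here refl)
... | here fx≡x        = ⊥-elim (no-fixed-point π (here refl) fx≡x)
... | there (here fx≡y) = endB x y (subst (λ z → _ ∣ x + z) fx≡y (divides-sum π (here refl)))
pairing-strategy (suc m) {d} {f} {b} u π len =
  moveB b (≤-trans (n≤1+n 3) (subst (4 ≤_) (sym len) (*-monoʳ-≤ 2 (s≤s (s≤s z≤n))))) reply
  where
  reply : ∀ {x} (p : x ∈ b) → AWinsA d (b ─ p)
  reply {x} p = moveA (b ─ p) (subst (3 ≤_) (sym len-p) (s≤s (*-monoʳ-≤ 2 (s≤s z≤n)))) q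
    (pairing-strategy m (Unique-─ (Unique-─ u p) q) (Pairing-─-pair u π p q)
      (suc-injective (trans (sym (length-removeAt′ (b ─ p) (index q))) len-p)))
    where
    q : f x ∈ (b ─ p)
    q = ∈-─⁺ p (closed π p) (no-fixed-point π p ∘ sym)

    len-p : length (b ─ p) ≡ suc (2 * suc m)
    len-p = suc-injective (trans (sym (length-removeAt′ b (index p))) (trans len (*-suc 2 (suc m))))

first-move-wins : ∀ m {d f s} {b : List ℕ} → Unique b → s ∈ b → Pairing ((_∈ b) ∖ ｛ s ｝) d f →
                  length b ≡ suc (2 * suc m) → AWinsA d b
first-move-wins m {b = b} u p π len =
  moveA b (subst (3 ≤_) (sym len) (s≤s (*-monoʳ-≤ 2 (s≤s z≤n)))) p
    (pairing-strategy m (Unique-─ u p) (Pairing-resp-≐ (≐-sym (∈-─≐ u p)) π)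
      (suc-injective (trans (sym (length-removeAt′ b (index p))) len)))

∈-initialBoard : ∀ {n} → (_∈ initialBoard n) ≐ Interval 1 n
∈-initialBoard =
  (λ y∈ → case ∈-applyUpTo⁻ suc y∈ of λ { (_ , i<n , refl) → s≤s z≤n , i<n }) ,
  (λ { (s≤s _ , y≤n) → ∈-applyUpTo⁺ suc y≤n })

initialBoard-unique : ∀ n → Unique (initialBoard n)
initialBoard-unique n = applyUpTo⁺₁ suc n (λ i<j _ → <⇒≢ i<j ∘ suc-injective)

FirstMovePairing : ℕ → ℕ → Set
FirstMovePairing n d = ∃₂ λ s f → Interval 1 n s × Pairing (Interval 1 n ∖ ｛ s ｝) d f

module _ {m : ℕ} where
  private
    k = suc m
    n = suc (2 * k)

  interval-split : Interval 1 (2 * k) ≐ (Interval 1 (suc (2 * m)) ∖ Half (2 * k)) ∪ ｛ k ｝ ∪ ｛ 2 * k ｝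
  interval-split = split , (λ { (inj₁ ((1≤y , y≤1+2m) , _)) → 1≤y , ≤-trans y≤1+2m 1+2m≤2k
                              ; (inj₂ (inj₁ refl))         → s≤s z≤n , m≤m+n k (k + 0)
                              ; (inj₂ (inj₂ refl))         → s≤s z≤n , ≤-refl })
    where
    1+2m≤2k : suc (2 * m) ≤ 2 * k
    1+2m≤2k = ≤-trans (n≤1+n _) (≤-reflexive (sym (*-suc 2 m)))

    split : Interval 1 (2 * k) ⊆ (Interval 1 (suc (2 * m)) ∖ Half (2 * k)) ∪ ｛ k ｝ ∪ ｛ 2 * k ｝
    split {y} (1≤y , y≤2k) with k ≟ y | 2 * k ≟ y
    ... | yes k≡y | _        = inj₂ (inj₁ k≡y)
    ... | no _    | yes 2k≡y = inj₂ (inj₂ 2k≡y)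
    ... | no k≢y  | no 2k≢y  =
      inj₁ ((1≤y , s≤s⁻¹ (≤∧≢⇒< (subst (y ≤_) (*-suc 2 m) y≤2k) (2k≢y ∘ trans (*-suc 2 m) ∘ sym))) ,
            λ 2y≡2k → k≢y (sym (*-cancelˡ-≡ y k 2 2y≡2k)))

  pairing-k : FirstMovePairing n k
  pairing-k = n , withPair k (2 * k) (2 * k ∸_) , (s≤s z≤n , ≤-refl) ,
    Pairing-resp-≐ (≐-sym (≐-trans Interval-∖-max interval-split))
      (Pairing-∪-pair (Pairing-∣ (n∣m*n 2) (reflection-pairing (sym (*-suc 2 m))))
        (λ (_ , k∉Half) → k∉Half refl)
        (λ ((_ , 2k≤1+2m) , _) → <⇒≱ (≤-reflexive (sym (*-suc 2 m))) 2k≤1+2m)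
        (<⇒≢ (m<m+n k (s≤s z≤n)))
        (∣m∣n⇒∣m+n ∣-refl (n∣m*n 2)))

  pairing-divisor-of-n+1 : ∀ {d} → d ∣ 2 * suc k → FirstMovePairing n d
  pairing-divisor-of-n+1 d∣ = suc k , 2 * suc k ∸_ , (s≤s z≤n , s≤s (m≤m+n k (k + 0))) ,
    Pairing-∣ d∣ (Pairing-resp-≐ (≐-sym ∖-｛｝≐∖-Half) (reflection-pairing (sym (*-suc 2 k))))

  pairing-n : FirstMovePairing n n
  pairing-n = n , n ∸_ , (s≤s z≤n , ≤-refl) ,
    Pairing-resp-≐ (≐-sym Interval-∖-max) (reflection-pairing-odd {1} {2 * k} {k} refl)

  pairing-n+2 : FirstMovePairing n (n + 2)
  pairing-n+2 = 1 , suc (2 * suc k) ∸_ , (≤-refl , s≤s z≤n) ,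
    Pairing-∣ (∣-reflexive (trans (+-comm n 2) 2+n≡))
      (Pairing-resp-≐ (≐-sym Interval-∖-min) (reflection-pairing-odd {2} {n} {suc k} 2+n≡))
    where
    2+n≡ : 2 + n ≡ suc (2 * suc k)
    2+n≡ = cong suc (sym (*-suc 2 k))

  first-move-pairing : ∀ {d} → d ∈ (k ∷ suc k ∷ n ∷ n + 1 ∷ n + 2 ∷ []) → FirstMovePairing n d
  first-move-pairing (here refl)                                 = pairing-k
  first-move-pairing (there (here refl))                         = pairing-divisor-of-n+1 (n∣m*n 2)
  first-move-pairing (there (there (here refl)))                 = pairing-n
  first-move-pairing (there (there (there (here refl))))         =
    pairing-divisor-of-n+1 (∣-reflexive (trans (+-comm n 1) (sym (*-suc 2 k))))
  first-move-pairing (there (there (there (there (here refl))))) = pairing-n+2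

theorem3p1p4 : ∀ (n k d : ℕ) → n ≡ 2 * k + 1 → 5 ≤ n →
    d ∈ (k ∷ suc k ∷ n ∷ n + 1 ∷ n + 2 ∷ []) →
    AHasWinningStrategy n d
theorem3p1p4 _ zero _ refl (s≤s ()) _
theorem3p1p4 n (suc m) d n≡2k+1 _ d∈ with refl ← trans n≡2k+1 (+-comm (2 * suc m) 1) =
  let s , f , s∈ , π = first-move-pairing d∈ in
  first-move-wins m (initialBoard-unique n) (proj₂ ∈-initialBoard s∈)
    (Pairing-resp-≐ (∖-respˡ-≐ (≐-sym ∈-initialBoard)) π) (length-applyUpTo suc n)
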